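{- Let $G$ be a diamond-free graph, and let $G \cup \{v\}$ be the graph obtained from $G$ by adding a new vertex $v \notin V(G)$ adjacent exactly to a given set $N(v) \subseteq V(G)$. Let $N'(v)$ be the set of edges of $G$ both of whose endpoints belong to $N(v)$. Say that $v$ is edge-adjacent to a clique $C$ of $G$ if $E(C) \cap N'(v) \neq \emptyset$, and fully edge-adjacent to $C$ if $E(C) \subseteq N'(v)$. Then $G \cup \{v\}$ is diamond-free if and only if, for every maximal clique $C$ of $G$ to which $v$ is edge-adjacent, the following two statements hold: (1) $v$ is fully edge-adjacent to $C$, and (2) for every maximal clique $C' \neq C$ of $G$ to which $v$ is edge-adjacent, $V(C') \cap V(C) = \emptyset$.
   Context: All graphs are finite, simple and undirected. A diamond is the graph obtained from $K_4$ by removing one edge; a graph is diamond-free if it has no induced subgraph isomorphic to a diamond. A clique is a set of pairwise adjacent vertices (identified with the subgraph it induces); it is maximal if it is not properly contained in another clique. -}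

module Defs where

open import Data.Nat using (ℕ; suc)
open import Data.Fin using (Fin; zero; suc)
open import Data.Fin.Subset using (Subset; _∈_; _⊆_; _∩_; Empty)
open import Data.Bool using (Bool; true; false)
open import Data.Vec using (lookup)
open import Data.Product using (Σ; ∃; _×_)
open import Relation.Binary.PropositionalEquality using (_≡_; _≢_)
open import Relation.Nullary using (¬_)

record Graph (n : ℕ) : Set where
  field
    adj    : Fin n → Fin n → Bool
    sym    : ∀ x y → adj x y ≡ adj y x
    irrefl : ∀ x → adj x x ≡ false
open Graph public

Adj : ∀ {n} → Graph n → Fin n → Fin n → Set
Adj G x y = adj G x y ≡ true

HasDiamond : ∀ {n} → Graph n → Set
HasDiamond {n} G =
  Σ (Fin n) λ a → Σ (Fin n) λ b → Σ (Fin n) λ c → Σ (Fin n) λ d →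
    a ≢ b × a ≢ c × a ≢ d × b ≢ c × b ≢ d × c ≢ d ×
    Adj G a b × Adj G a c × Adj G a d × Adj G b c × Adj G b d × ¬ Adj G c d

DiamondFree : ∀ {n} → Graph n → Set
DiamondFree G = ¬ HasDiamond G

IsClique : ∀ {n} → Graph n → Subset n → Set
IsClique G C = ∀ x y → x ∈ C → y ∈ C → x ≢ y → Adj G x y

IsMaximalClique : ∀ {n} → Graph n → Subset n → Set
IsMaximalClique G C = IsClique G C × (∀ D → IsClique G D → C ⊆ D → D ⊆ C)

-- G ∪ {v}: new vertex v is `zero`, old vertex x becomes `suc x`;
-- v is adjacent exactly to the vertices in N.
extAdj : ∀ {n} → Graph n → Subset n → Fin (suc n) → Fin (suc n) → Bool
extAdj G N zero    zero    = false
extAdj G N zero    (suc y) = lookup N y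
extAdj G N (suc x) zero    = lookup N x
extAdj G N (suc x) (suc y) = adj G x y

extSym : ∀ {n} (G : Graph n) (N : Subset n) x y → extAdj G N x y ≡ extAdj G N y x
extSym G N zero    zero    = Relation.Binary.PropositionalEquality.refl
extSym G N zero    (suc y) = Relation.Binary.PropositionalEquality.refl
extSym G N (suc x) zero    = Relation.Binary.PropositionalEquality.refl
extSym G N (suc x) (suc y) = sym G x y

extIrrefl : ∀ {n} (G : Graph n) (N : Subset n) x → extAdj G N x x ≡ false
extIrrefl G N zero    = Relation.Binary.PropositionalEquality.refl
extIrrefl G N (suc x) = irrefl G x

addVertex : ∀ {n} → Graph n → Subset n → Graph (suc n)
addVertex G N = record { adj = extAdj G N ; sym = extSym G N ; irrefl = extIrrefl G N }

InN' : ∀ {n} → Graph n → Subset n → Fin n → Fin n → Set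
InN' G N x y = Adj G x y × x ∈ N × y ∈ N

InEdgesOf : ∀ {n} → Graph n → Subset n → Fin n → Fin n → Set
InEdgesOf G C x y = Adj G x y × x ∈ C × y ∈ C

EdgeAdjacent : ∀ {n} → Graph n → Subset n → Subset n → Set
EdgeAdjacent {n} G N C =
  Σ (Fin n) λ x → Σ (Fin n) λ y → InEdgesOf G C x y × InN' G N x y

FullyEdgeAdjacent : ∀ {n} → Graph n → Subset n → Subset n → Set
FullyEdgeAdjacent G N C = ∀ x y → InEdgesOf G C x y → InN' G N x y

Condition : ∀ {n} → Graph n → Subset n → Set
Condition G N =
  ∀ C → IsMaximalClique G C → EdgeAdjacent G N C →
    FullyEdgeAdjacent G N C ×
    (∀ C' → IsMaximalClique G C' → C' ≢ C → EdgeAdjacent G N C' → Empty (C' ∩ C))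

module Submission where

-- Write H = G ∪ {v}; in H the new vertex v is `zero` and an old
-- vertex x is `suc x`.  An induced diamond of H either avoids v (so it is a
-- diamond of G), or has v as one of its two degree-3 vertices, or as one of
-- its two degree-2 vertices.  Translated back to G these last two shapes are
--   * an apex configuration: b, c, d ∈ N(v), bc and bd edges, cd a non-edge;
--   * a wing configuration:  a triangle xyz with x, y ∈ N(v) and z ∉ N(v).
-- So for diamond-free G, H is diamond-free iff G has neither configuration.
--   (⇒) No wing: a clique with an edge inside N(v) lies inside N(v), giving (1).
--       No apex: a clique inside N(v) meeting a maximal clique inside N(v) is
--       contained in it, so two such maximal cliques that meet are equal (2).
--   (⇐) Extend a wing triangle to a maximal clique and (1) fails; extend the
--       edges bc, bd of an apex to maximal cliques and (2) fails.
-- The only general tool needed is that every clique of a finite graph lies in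
-- a maximal clique, proved by well-founded growth of subsets of Fin n.

open import Defs
open import Data.Nat using (ℕ)
open import Data.Bool using (true) renaming (_≟_ to _≟ᵇ_)
open import Data.Vec using (lookup)
open import Data.Fin using (Fin; zero; suc)
open import Data.Fin.Properties using (suc-injective; any?; all?)
open import Data.Fin.Subset using (Subset; _∈_; _∉_; _⊆_; _⊃_; _∪_; _∩_; ⁅_⁆; Empty)
open import Data.Fin.Subset.Properties
  using (_∈?_; ⊆-antisym; x∈⁅x⁆; x∈⁅y⁆⇒x≡y; p⊆p∪q; q⊆p∪q; x∈p∪q⁻; x∈p∩q⁻; x∈p∩q⁺)
open import Data.Fin.Subset.Induction using (Acc; acc; ⊃-wellFounded)
open import Data.Vec.Properties using ([]=⇒lookup; lookup⇒[]=)
open import Data.Product using (Σ; ∃; _×_; _,_; proj₁; proj₂)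
open import Data.Sum using (_⊎_; inj₁; inj₂)
open import Data.Empty using (⊥-elim)
open import Function using (_∘_)
open import Relation.Nullary using (¬_; Dec; yes; no)
open import Relation.Nullary.Decidable using (¬?; _×-dec_; _→-dec_)
open import Relation.Binary.PropositionalEquality using (_≡_; _≢_; refl; cong; subst; trans)
  renaming (sym to ≡-sym)

module _ {n : ℕ} (G : Graph n) where

  adj? : ∀ x y → Dec (Adj G x y)
  adj? x y = adj G x y ≟ᵇ true

  adjSym : ∀ {x y} → Adj G x y → Adj G y x
  adjSym {x} {y} xy = trans (sym G y x) xy

  adj⇒≢ : ∀ {x y} → Adj G x y → x ≢ y
  adj⇒≢ {x} xx refl with trans (≡-sym (irrefl G x)) xx
  ... | ()

  insertClique : ∀ {C x} → IsClique G C → (∀ y → y ∈ C → Adj G x y) →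
                 IsClique G (⁅ x ⁆ ∪ C)
  insertClique {C} {x} clC toC u w uD wD u≢w
    with x∈p∪q⁻ ⁅ x ⁆ C uD | x∈p∪q⁻ ⁅ x ⁆ C wD
  ... | inj₁ u∈x | inj₁ w∈x = ⊥-elim (u≢w (trans (x∈⁅y⁆⇒x≡y x u∈x) (≡-sym (x∈⁅y⁆⇒x≡y x w∈x))))
  ... | inj₁ u∈x | inj₂ wC  = subst (λ u → Adj G u w) (≡-sym (x∈⁅y⁆⇒x≡y x u∈x)) (toC w wC)
  ... | inj₂ uC  | inj₁ w∈x = subst (Adj G u) (≡-sym (x∈⁅y⁆⇒x≡y x w∈x)) (adjSym (toC u uC))
  ... | inj₂ uC  | inj₂ wC  = clC u w uC wC u≢w

  singletonClique : ∀ x → IsClique G ⁅ x ⁆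
  singletonClique x u w u∈x w∈x u≢w =
    ⊥-elim (u≢w (trans (x∈⁅y⁆⇒x≡y x u∈x) (≡-sym (x∈⁅y⁆⇒x≡y x w∈x))))

  edgeClique : ∀ {x y} → Adj G x y → IsClique G (⁅ x ⁆ ∪ ⁅ y ⁆)
  edgeClique {x} {y} xy = insertClique (singletonClique y)
    (λ u u∈y → subst (Adj G x) (≡-sym (x∈⁅y⁆⇒x≡y y u∈y)) xy)

  triangleClique : ∀ {x y z} → Adj G x y → Adj G x z → Adj G y z →
                   IsClique G (⁅ x ⁆ ∪ (⁅ y ⁆ ∪ ⁅ z ⁆))
  triangleClique {x} {y} {z} xy xz yz = insertClique (edgeClique yz) toEdge
    where
    toEdge : ∀ u → u ∈ ⁅ y ⁆ ∪ ⁅ z ⁆ → Adj G x u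
    toEdge u u∈yz with x∈p∪q⁻ ⁅ y ⁆ ⁅ z ⁆ u∈yz
    ... | inj₁ u∈y = subst (Adj G x) (≡-sym (x∈⁅y⁆⇒x≡y y u∈y)) xy
    ... | inj₂ u∈z = subst (Adj G x) (≡-sym (x∈⁅y⁆⇒x≡y z u∈z)) xz

  Extends : Subset n → Fin n → Set
  Extends C x = x ∉ C × (∀ y → y ∈ C → Adj G x y)

  extends? : ∀ C x → Dec (Extends C x)
  extends? C x = ¬? (x ∈? C) ×-dec all? (λ y → y ∈? C →-dec adj? x y)

  unextendable⇒maximal : ∀ {C} → IsClique G C → ¬ ∃ (Extends C) → IsMaximalClique G C
  unextendable⇒maximal {C} clC none = clC , maximal
    where
    maximal : ∀ D → IsClique G D → C ⊆ D → D ⊆ C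
    maximal D clD C⊆D {y} yD with y ∈? C
    ... | yes yC = yC
    ... | no y∉C = ⊥-elim (none (y , y∉C , λ u uC →
            clD y u yD (C⊆D uC) (λ { refl → y∉C uC })))

  -- Grow a clique one extending vertex at a time; the subsets of Fin n are
  -- well-founded under ⊃, so the process stops at a maximal clique.
  growToMaximal : ∀ C → Acc _⊃_ C → IsClique G C →
                  Σ (Subset n) λ M → IsMaximalClique G M × C ⊆ M
  growToMaximal C (acc larger) clC with any? (extends? C)
  ... | no none = C , unextendable⇒maximal clC none , (λ yC → yC)
  ... | yes (x , x∉C , toC) with growToMaximal (⁅ x ⁆ ∪ C) (larger C⊂C') (insertClique clC toC)
    where
    C⊂C' : (⁅ x ⁆ ∪ C) ⊃ C
    C⊂C' = q⊆p∪q ⁅ x ⁆ C , x , p⊆p∪q C (x∈⁅x⁆ x) , x∉C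
  ... | M , maxM , C'⊆M = M , maxM , λ yC → C'⊆M (q⊆p∪q ⁅ x ⁆ C yC)

  maximalCliqueAbove : ∀ {C} → IsClique G C → Σ (Subset n) λ M → IsMaximalClique G M × C ⊆ M
  maximalCliqueAbove {C} = growToMaximal C (⊃-wellFounded C)

∈⇒adjNew : ∀ {n} {N : Subset n} {x} → x ∈ N → lookup N x ≡ true
∈⇒adjNew = []=⇒lookup

adjNew⇒∈ : ∀ {n} {N : Subset n} {x} → lookup N x ≡ true → x ∈ N
adjNew⇒∈ {N = N} {x} = lookup⇒[]= x N

liftNeq : ∀ {n} {x y : Fin n} → x ≢ y → suc x ≢ suc y
liftNeq x≢y = x≢y ∘ suc-injective

module _ {n : ℕ} (G : Graph n) (N : Subset n) where

  -- The trace in G of a diamond of G ∪ {v} in which v has degree 3.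
  ApexConfiguration : Set
  ApexConfiguration = Σ (Fin n) λ b → Σ (Fin n) λ c → Σ (Fin n) λ d →
    b ∈ N × c ∈ N × d ∈ N × Adj G b c × Adj G b d × c ≢ d × ¬ Adj G c d

  -- The trace in G of a diamond of G ∪ {v} in which v has degree 2.
  WingConfiguration : Set
  WingConfiguration = Σ (Fin n) λ x → Σ (Fin n) λ y → Σ (Fin n) λ z →
    x ∈ N × y ∈ N × z ∉ N × Adj G x y × Adj G x z × Adj G y z

  apexDiamond : ApexConfiguration → HasDiamond (addVertex G N)
  apexDiamond (b , c , d , bN , cN , dN , bc , bd , c≢d , ¬cd) =
    zero , suc b , suc c , suc d ,
    (λ ()) , (λ ()) , (λ ()) , liftNeq (adj⇒≢ G bc) , liftNeq (adj⇒≢ G bd) , liftNeq c≢d ,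
    ∈⇒adjNew bN , ∈⇒adjNew cN , ∈⇒adjNew dN , bc , bd , ¬cd

  wingDiamond : WingConfiguration → HasDiamond (addVertex G N)
  wingDiamond (x , y , z , xN , yN , z∉N , xy , xz , yz) =
    suc x , suc y , zero , suc z ,
    liftNeq (adj⇒≢ G xy) , (λ ()) , liftNeq (adj⇒≢ G xz) , (λ ()) , liftNeq (adj⇒≢ G yz) , (λ ()) ,
    xy , ∈⇒adjNew xN , xz , ∈⇒adjNew yN , yz , z∉N ∘ adjNew⇒∈

  classifyDiamond : HasDiamond (addVertex G N) →
                    HasDiamond G ⊎ ApexConfiguration ⊎ WingConfiguration
  classifyDiamond (suc a , suc b , suc c , suc d , ab , ac , ad , bc , bd , cd , eab , eac , ead , ebc , ebd , ¬cd) =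
    inj₁ (a , b , c , d , ab ∘ cong suc , ac ∘ cong suc , ad ∘ cong suc ,
          bc ∘ cong suc , bd ∘ cong suc , cd ∘ cong suc , eab , eac , ead , ebc , ebd , ¬cd)
  classifyDiamond (zero , suc b , suc c , suc d , _ , _ , _ , _ , _ , cd , eab , eac , ead , ebc , ebd , ¬cd) =
    inj₂ (inj₁ (b , c , d , adjNew⇒∈ eab , adjNew⇒∈ eac , adjNew⇒∈ ead , ebc , ebd , cd ∘ cong suc , ¬cd))
  classifyDiamond (suc a , zero , suc c , suc d , _ , _ , _ , _ , _ , cd , eab , eac , ead , ebc , ebd , ¬cd) =
    inj₂ (inj₁ (a , c , d , adjNew⇒∈ eab , adjNew⇒∈ ebc , adjNew⇒∈ ebd , eac , ead , cd ∘ cong suc , ¬cd))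
  classifyDiamond (suc a , suc b , zero , suc d , _ , _ , _ , _ , _ , _ , eab , eac , ead , ebc , ebd , ¬cd) =
    inj₂ (inj₂ (a , b , d , adjNew⇒∈ eac , adjNew⇒∈ ebc , ¬cd ∘ ∈⇒adjNew , eab , ead , ebd))
  classifyDiamond (suc a , suc b , suc c , zero , _ , _ , _ , _ , _ , _ , eab , eac , ead , ebc , ebd , ¬cd) =
    inj₂ (inj₂ (a , b , c , adjNew⇒∈ ead , adjNew⇒∈ ebd , ¬cd ∘ ∈⇒adjNew , eab , eac , ebc))
  classifyDiamond (zero , zero , _ , _ , ab , _) = ⊥-elim (ab refl)
  classifyDiamond (zero , suc _ , zero , _ , _ , ac , _) = ⊥-elim (ac refl)
  classifyDiamond (zero , suc _ , suc _ , zero , _ , _ , ad , _) = ⊥-elim (ad refl)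
  classifyDiamond (suc _ , zero , zero , _ , _ , _ , _ , bc , _) = ⊥-elim (bc refl)
  classifyDiamond (suc _ , zero , suc _ , zero , _ , _ , _ , _ , bd , _) = ⊥-elim (bd refl)
  classifyDiamond (suc _ , suc _ , zero , zero , _ , _ , _ , _ , _ , cd , _) = ⊥-elim (cd refl)

  cliqueInsideNeighbourhood : ¬ WingConfiguration → ∀ {C} → IsClique G C →
                              EdgeAdjacent G N C → C ⊆ N
  cliqueInsideNeighbourhood noWing clC (x , y , (xy , xC , yC) , (_ , xN , yN)) {z} zC
    with z ∈? N
  ... | yes zN  = zN
  ... | no z∉N  = ⊥-elim (noWing (x , y , z , xN , yN , z∉N , xy ,
                    clC x z xC zC (λ { refl → z∉N xN }) , clC y z yC zC (λ { refl → z∉N yN })))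

  -- Without apexes, a clique A inside N meeting a maximal clique B inside N
  -- is contained in B: each p ∈ A is adjacent to all of B (a common vertex w
  -- and a non-neighbour q of p in B would form an apex), so maximality of B
  -- forces p ∈ B.
  cliqueAbsorbed : ¬ ApexConfiguration → ∀ {A B w} → IsClique G A → A ⊆ N →
                   IsMaximalClique G B → B ⊆ N → w ∈ A → w ∈ B → A ⊆ B
  cliqueAbsorbed noApex {A} {B} {w} clA A⊆N (clB , maxB) B⊆N wA wB {p} pA with p ∈? B
  ... | yes pB  = pB
  ... | no p∉B = maxB (⁅ p ⁆ ∪ B) (insertClique G clB toB) (q⊆p∪q ⁅ p ⁆ B) (p⊆p∪q B (x∈⁅x⁆ p))
    where
    w≢p : w ≢ p
    w≢p refl = p∉B wB
    toB : ∀ q → q ∈ B → Adj G p q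
    toB q qB with adj? G p q
    ... | yes pq = pq
    ... | no ¬pq = ⊥-elim (noApex (w , p , q , B⊆N wB , A⊆N pA , B⊆N qB ,
            clA w p wA pA w≢p , clB w q wB qB w≢q , (λ { refl → p∉B qB }) , ¬pq))
      where
      w≢q : w ≢ q
      w≢q refl = ¬pq (clA p w pA wA (w≢p ∘ ≡-sym))

  conditionFromNoConfigurations : ¬ ApexConfiguration → ¬ WingConfiguration → Condition G N
  conditionFromNoConfigurations noApex noWing C (clC , maxC) adjC = fully , disjoint
    where
    C⊆N : C ⊆ N
    C⊆N = cliqueInsideNeighbourhood noWing clC adjC
    fully : FullyEdgeAdjacent G N C
    fully x y (xy , xC , yC) = xy , C⊆N xC , C⊆N yC
    disjoint : ∀ C' → IsMaximalClique G C' → C' ≢ C → EdgeAdjacent G N C' → Empty (C' ∩ C)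
    disjoint C' (clC' , maxC') C'≢C adjC' (w , wC'C) =
      C'≢C (⊆-antisym (cliqueAbsorbed noApex clC' C'⊆N (clC , maxC) C⊆N wC' wC)
                      (cliqueAbsorbed noApex clC C⊆N (clC' , maxC') C'⊆N wC wC'))
      where
      C'⊆N : C' ⊆ N
      C'⊆N = cliqueInsideNeighbourhood noWing clC' adjC'
      wC' : w ∈ C'
      wC' = proj₁ (x∈p∩q⁻ C' C wC'C)
      wC : w ∈ C
      wC = proj₂ (x∈p∩q⁻ C' C wC'C)

  edgeInside : ∀ {C x y} → Adj G x y → x ∈ N → y ∈ N → x ∈ C → y ∈ C → EdgeAdjacent G N C
  edgeInside xy xN yN xC yC = _ , _ , (xy , xC , yC) , (xy , xN , yN)

  -- (⇐) A wing triangle lies in a maximal clique that is edge-adjacent through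
  -- xy but not fully edge-adjacent, since z ∉ N: condition (1) fails.
  noWingConfiguration : Condition G N → ¬ WingConfiguration
  noWingConfiguration cond (x , y , z , xN , yN , z∉N , xy , xz , yz)
    with maximalCliqueAbove G (triangleClique G xy xz yz)
  ... | M , maxM , T⊆M = z∉N (proj₂ (proj₂ (fully x z (xz , xM , zM))))
    where
    xM : x ∈ M
    xM = T⊆M (p⊆p∪q _ (x∈⁅x⁆ x))
    yM : y ∈ M
    yM = T⊆M (q⊆p∪q ⁅ x ⁆ _ (p⊆p∪q _ (x∈⁅x⁆ y)))
    zM : z ∈ M
    zM = T⊆M (q⊆p∪q ⁅ x ⁆ _ (q⊆p∪q ⁅ y ⁆ _ (x∈⁅x⁆ z)))
    fully : FullyEdgeAdjacent G N M
    fully = proj₁ (cond M maxM (edgeInside xy xN yN xM yM))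

  -- (⇐) For an apex, maximal cliques M ⊇ {b, c} and M' ⊇ {b, d} are both
  -- edge-adjacent and share b, yet differ since cd is a non-edge: (2) fails.
  noApexConfiguration : Condition G N → ¬ ApexConfiguration
  noApexConfiguration cond (b , c , d , bN , cN , dN , bc , bd , c≢d , ¬cd)
    with maximalCliqueAbove G (edgeClique G bc) | maximalCliqueAbove G (edgeClique G bd)
  ... | M , maxM , bc⊆M | M' , maxM' , bd⊆M' =
    proj₂ (cond M maxM (edgeInside bc bN cN bM cM)) M' maxM' M'≢M
      (edgeInside bd bN dN bM' dM') (b , x∈p∩q⁺ (bM' , bM))
    where
    bM : b ∈ M
    bM = bc⊆M (p⊆p∪q _ (x∈⁅x⁆ b))
    cM : c ∈ M
    cM = bc⊆M (q⊆p∪q ⁅ b ⁆ _ (x∈⁅x⁆ c))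
    bM' : b ∈ M'
    bM' = bd⊆M' (p⊆p∪q _ (x∈⁅x⁆ b))
    dM' : d ∈ M'
    dM' = bd⊆M' (q⊆p∪q ⁅ b ⁆ _ (x∈⁅x⁆ d))
    M'≢M : M' ≢ M
    M'≢M refl = ¬cd (proj₁ maxM c d cM dM' c≢d)

theorem5 : ∀ {n} (G : Graph n) (N : Subset n) → DiamondFree G →
    (DiamondFree (addVertex G N) → Condition G N) × (Condition G N → DiamondFree (addVertex G N))
theorem5 G N dfG = necessary , sufficient
  where
  necessary : DiamondFree (addVertex G N) → Condition G N
  necessary dfH = conditionFromNoConfigurations G N (dfH ∘ apexDiamond G N) (dfH ∘ wingDiamond G N)
  sufficient : Condition G N → DiamondFree (addVertex G N)
  sufficient cond diamond with classifyDiamond G N diamond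
  ... | inj₁ inG          = dfG inG
  ... | inj₂ (inj₁ apex)  = noApexConfiguration G N cond apex
  ... | inj₂ (inj₂ wing)  = noWingConfiguration G N cond wing
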